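{- In the setting of the context, measure traveling distance under Assumption A (the cyclic travel distance defined in the context). Then the traveling distance of team $t$ in $K^*_{\mathrm{DRR}}$ is at most $\tau' + d_{v_t v^*} + d_{v^* v_{t+1}} - d_{v_t v_{t+1}}$ if $t\in\{0,1,\dots,n/2-1\}$; at most $\tau' + d_{v_{t-1}v^*} + d_{v^*v_t} - d_{v_{t-1}v_t}$ if $t\in\{n/2,\dots,n-2\}$; and at most $n\tau/2$ if $t=n-1$. Here $\tau'$ is the length of the cycle $(v_0,\dots,v_{n-2})$ and $\tau$ the length of a shortest Hamilton cycle of $G$.
   Context: $n\ge4$ even teams; $d_{ij}\ge0$ is the distance between home venues of teams $i,j$, with $d_{ii}=0$, symmetry, triangle inequality. $G$ is the complete graph on the set $V$ of home venues with edge lengths $d_{vv'}$. A game "$i$ at $j$" is played at $j$'s venue. $v^*$ is a vertex attaining $\min_{v\in V}\sum_{v'\in V\setminus\{v\}}d_{vv'}$, its team named $n-1$; $(v_0,\dots,v_{n-2})$ is the Hamilton cycle on $V\setminus\{v^*\}$ produced by Christofides' 1.5-approximation algorithm, and the team with venue $v_i$ is named $i$; indices of $v$ are taken mod $n-1$ ($v_{n-1}=v_0$, $v_{ -1}=v_{n-2}$). For $t\in\{0,\dots,n-1\}$, $s\in\{0,\dots,n-2\}$: $K^*(t,s)=s-t\pmod{n-1}$ if $t\ne n-1$ and $s-t\not\equiv t\pmod{n-1}$; $K^*(t,s)=n-1$ if $t\ne n-1$ and $s-t\equiv t\pmod{n-1}$; $K^*(n-1,s)=s/2$ for $s$ even,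 $(s+n-1)/2$ for $s$ odd. $K^*_{\mathrm{DRR}}$ (slots $0,\dots,2n-3$): in slots $s$ and $s+n-1$ team $t$ plays $K^*(t,s)$; for $t\in\{0,\dots,n/2-1\}$ games in slots $2t,\dots,n+2t-2$ are home, others away; for $t\in\{n/2,\dots,n-2\}$ games in slots $2t-n+2,\dots,2t$ are away, others home; team $n-1$ is away in slots $0,\dots,n-2$, home otherwise. Assumption A: instead of the usual rule (start at home, return home after the tournament), if a team plays away games in both the first and last slots it travels from the venue of the last game directly to the venue of the first game instead of the trips before the first slot and after the last slot; equivalently, the traveling distance of a team is $\sum_{s=0}^{2n-3} d(w_s,w_{s+1})$ where $w_s$ is the venue of its game in slot $s$ and $w_{2n-2}=w_0$.
   Formalization: The distances $d_{ij}$ between home venues take rational values. -}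

module Defs where

open import Data.Nat using (ℕ; zero; suc; _∸_; _≤ᵇ_; _≡ᵇ_; NonZero; _+_; _*_)
open import Data.Nat.DivMod using (_%_; _/_; m%n<n)
open import Data.Bool using (Bool; true; false; if_then_else_; _∧_)
open import Data.Fin using (Fin; toℕ; fromℕ<)
open import Data.Rational using (ℚ; 0ℚ) renaming (_+_ to _+ℚ_)
open import Data.Fin.Permutation using (Permutation′; _⟨$⟩ʳ_)

sumTo : ℕ → (ℕ → ℚ) → ℚ
sumTo zero    f = 0ℚ
sumTo (suc m) f = sumTo m f +ℚ f m

-- k mod m (with the convention k mod 0 = k; only used for m ≥ 1)
_mod_ : ℕ → ℕ → ℕ
k mod zero  = k
k mod suc m = k % suc m

idx : (n : ℕ) → .{{_ : NonZero n}} → ℕ → Fin n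
idx n k = fromℕ< (m%n<n k n)

between : ℕ → ℕ → ℕ → Bool
between a b k = (a ≤ᵇ k) ∧ (k ≤ᵇ b)

Kstar : (n : ℕ) → ℕ → ℕ → ℕ
Kstar n t s with t ≡ᵇ (n ∸ 1)
... | true  = if (s % 2) ≡ᵇ 0 then s / 2 else (s + (n ∸ 1)) / 2
... | false = let r = ((s + (n ∸ 1)) ∸ t) mod (n ∸ 1)
              in if r ≡ᵇ t then n ∸ 1 else r

isHome : (n : ℕ) → ℕ → ℕ → Bool
isHome n t s with t ≡ᵇ (n ∸ 1)
... | true = if s ≤ᵇ (n ∸ 2) then false else true
... | false = if suc t ≤ᵇ (n / 2)
                then between (2 * t) ((n + 2 * t) ∸ 2) s
                else (if between (((2 * t) + 2) ∸ n) (2 * t) s then false else true)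

-- opponent of team t in slot s of K*_DRR (slots s and s+n-1 use K*(t,s))
oppDRR : (n : ℕ) → ℕ → ℕ → ℕ
oppDRR n t s = Kstar n t (s mod (n ∸ 1))

venue : (n : ℕ) → ℕ → ℕ → ℕ
venue n t s = if isHome n t s then t else oppDRR n t s

travelA : (n : ℕ) → .{{_ : NonZero n}} → (Fin n → Fin n → ℚ) → ℕ → ℚ
travelA n d t =
  sumTo (2 * n ∸ 2) (λ s → d (idx n (venue n t s))
                              (idx n (venue n t ((suc s) mod (2 * n ∸ 2)))))

-- τ' : length of the cycle (v_0, …, v_{n-2}) (team i has venue v_i)
tauPrime : (n : ℕ) → .{{_ : NonZero n}} → (Fin n → Fin n → ℚ) → ℚ
tauPrime n d = sumTo (n ∸ 1) (λ i → d (idx n i) (idx n ((suc i) mod (n ∸ 1))))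

-- length of the Hamilton cycle of G visiting venues in the order π(0), …, π(n-1)
cycleLength : (n : ℕ) → .{{_ : NonZero n}} → (Fin n → Fin n → ℚ) → Permutation′ n → ℚ
cycleLength n d π = sumTo n (λ i → d (π ⟨$⟩ʳ idx n i) (π ⟨$⟩ʳ idx n (suc i)))

rowSum : (n : ℕ) → .{{_ : NonZero n}} → (Fin n → Fin n → ℚ) → Fin n → ℚ
rowSum n d v = sumTo n (λ j → if j ≡ᵇ toℕ v then 0ℚ else d v (idx n j))

module Submission where

-- Under Assumption A the travel of a team is the length of the closed walk through the venues
-- of its 2(n-1) games.  Module Cycles develops closed walks over lists of vertices: their length
-- is invariant under rotation, a block of repeated vertices (consecutive games at one venue)
-- collapses to one vertex, and replacing an edge a → b by a detour a → x → b adds exactly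
-- δ a x + δ x b - δ a b; in a metric, the round trip between two vertices of a closed walk is at
-- most its length, so every distance is at most half the length of a Hamilton cycle.
-- Module Venues computes from the definition of K*_DRR the sequence of venues of each team: a
-- team t < n/2 (resp. n/2 ≤ t ≤ n-2) walks the cycle τ' = (v₀, …, v_{n-2}) once, waiting at home
-- and detouring to v* between v_t and v_{t+1} (resp. between v_{t-1} and v_t), while team n-1
-- visits its n-1 opponents and then stays home.  Module Tours turns this into the identity
-- travel + d(v_t, v_{t+1}) = τ' + d(v_t, v*) + d(v*, v_{t+1}) (and its mirror image), and bounds
-- the walk of team n-1, which has n edges, by n · τ/2.  Module Setting identifies the sums of the
-- definitions with closed walks, and the theorem splits n = 2(k+2) into its three cases.

open import Defs
open import Data.Nat using (ℕ; NonZero; _∸_; suc) renaming (_≤_ to _≤ℕ_; _<_ to _<ℕ_; _/_ to _/ℕ_)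
open import Data.Nat as ℕ using (zero; s≤s; z≤n; >-nonZero; pred)
import Data.Nat.Properties as ℕ
open import Data.Nat.DivMod using (_%_; n%n≡0; m<n⇒m%n≡m; m%n%n≡m%n; m*n/n≡m)
open import Data.Nat.Divisibility using (_∣_; divides)
open import Data.Nat.Tactic.RingSolver renaming (solve to ℕ-solve)
open import Data.List using (List; []; _∷_; _++_; replicate; length; map)
open import Data.List.Properties using (map-id; map-++; ++-assoc; ++-identityʳ; length-++-sucʳ; length-++; length-map)
open import Data.List.Membership.Propositional using (_∈_)
open import Data.List.Membership.Propositional.Properties using (∈-∃++; ∈-++⁻; ∈-++⁺ˡ; ∈-++⁺ʳ; ∈-map⁺)
open import Data.List.Relation.Unary.Any using (here; there)
open import Data.Product using (_×_; _,_)
open import Data.Sum using (_⊎_; inj₁; inj₂)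
open import Function using (_∘_)
open import Relation.Binary.PropositionalEquality

range : ℕ → ℕ → List ℕ
range a zero    = []
range a (suc k) = a ∷ range (suc a) k

range-++ : ∀ a j k → range a (j ℕ.+ k) ≡ range a j ++ range (a ℕ.+ j) k
range-++ a zero    k = cong (λ b → range b k) (sym (ℕ.+-identityʳ a))
range-++ a (suc j) k = cong (a ∷_) (trans (range-++ (suc a) j k) (cong (λ b → range (suc a) j ++ range b k) (sym (ℕ.+-suc a j))))

range-snoc : ∀ a k → range a (suc k) ≡ range a k ++ a ℕ.+ k ∷ []
range-snoc a k = trans (cong (range a) (ℕ.+-comm 1 k)) (range-++ a k 1)

length-range : ∀ a k → length (range a k) ≡ k
length-range a zero    = refl
length-range a (suc k) = cong suc (length-range (suc a) k)

∈-range : ∀ a {m} k → k <ℕ m → a ℕ.+ k ∈ range a m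
∈-range a {suc m} zero    _         = here (ℕ.+-identityʳ a)
∈-range a {suc m} (suc k) (s≤s k<m) = there (subst (_∈ range (suc a) m) (sym (ℕ.+-suc a k)) (∈-range (suc a) k k<m))

map-range-shift : ∀ {A : Set} (f g : ℕ → A) a b k → (∀ u → u <ℕ k → f (a ℕ.+ u) ≡ g (b ℕ.+ u)) →
                  map f (range a k) ≡ map g (range b k)
map-range-shift f g a b zero    eq = refl
map-range-shift f g a b (suc k) eq = cong₂ _∷_
  (subst₂ (λ a′ b′ → f a′ ≡ g b′) (ℕ.+-identityʳ a) (ℕ.+-identityʳ b) (eq 0 (s≤s z≤n)))
  (map-range-shift f g (suc a) (suc b) k (λ u u<k →
    subst₂ (λ a′ b′ → f a′ ≡ g b′) (ℕ.+-suc a u) (ℕ.+-suc b u) (eq (suc u) (s≤s u<k))))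

map-range-translate : ∀ f a b k → (∀ u → u <ℕ k → f (a ℕ.+ u) ≡ b ℕ.+ u) → map f (range a k) ≡ range b k
map-range-translate f a b k eq = trans (map-range-shift f (λ x → x) a b k eq) (map-id (range b k))

map-range-const : ∀ {A : Set} (f : ℕ → A) a c k → (∀ u → u <ℕ k → f (a ℕ.+ u) ≡ c) → map f (range a k) ≡ replicate k c
map-range-const f a c zero    eq = refl
map-range-const f a c (suc k) eq = cong₂ _∷_ (subst (λ a′ → f a′ ≡ c) (ℕ.+-identityʳ a) (eq 0 (s≤s z≤n)))
  (map-range-const f (suc a) c k (λ u u<k → subst (λ a′ → f a′ ≡ c) (ℕ.+-suc a u) (eq (suc u) (s≤s u<k))))

module Venues where
  open import Data.Nat using (_+_; _*_; _≤_; _<_; _≤ᵇ_; _≡ᵇ_; _≤?_; _≟_; _/_)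
  open import Data.Nat.Properties
  open import Data.Nat.DivMod using (%-distribˡ-+; [m+kn]%n≡m%n; m<n*o⇒m/o<n; /-monoˡ-≤)
  open import Data.Bool using (true; false; if_then_else_)
  open import Relation.Nullary.Decidable using (dec-true; dec-false)

  ≤ᵇ-true : ∀ {a b} → a ≤ b → (a ≤ᵇ b) ≡ true
  ≤ᵇ-true {a} {b} = dec-true (a ≤? b)

  ≤ᵇ-false : ∀ {a b} → b < a → (a ≤ᵇ b) ≡ false
  ≤ᵇ-false {a} {b} b<a = dec-false (a ≤? b) (<⇒≱ b<a)

  ≡ᵇ-refl : ∀ a → (a ≡ᵇ a) ≡ true
  ≡ᵇ-refl a = dec-true (a ≟ a) refl

  ≡ᵇ-false : ∀ {a b} → a ≢ b → (a ≡ᵇ b) ≡ false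
  ≡ᵇ-false {a} {b} = dec-false (a ≟ b)

  ≤-from-+ : ∀ {a b} k → a + k ≡ b → a ≤ b
  ≤-from-+ {a} k refl = m≤m+n a k

  <-from-+ : ∀ {a b} k → a + suc k ≡ b → a < b
  <-from-+ {a} k refl = ≤-from-+ k (sym (+-suc a k))

  map-range-++ : ∀ {A : Set} (f : ℕ → A) a j k → map f (range a (j + k)) ≡ map f (range a j) ++ map f (range (a + j) k)
  map-range-++ f a j k = trans (cong (map f) (range-++ a j k)) (map-++ f (range a j) (range (a + j) k))

  -- The schedule K*_DRR for n = M + 2 teams; N = n - 1 is the special team v*.
  module Schedule (M : ℕ) where
    N : ℕ
    N = suc M
    n : ℕ
    n = suc N

    isHome-low : ∀ t s → t < N → suc t ≤ n / 2 → isHome n t s ≡ between (2 * t) (M + 2 * t) s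
    isHome-low t s t<N low rewrite ≡ᵇ-false (<⇒≢ t<N) | ≤ᵇ-true low = refl

    isHome-high : ∀ t s → t < N → n / 2 < suc t →
                  isHome n t s ≡ (if between (2 * t + 2 ∸ n) (2 * t) s then false else true)
    isHome-high t s t<N high rewrite ≡ᵇ-false (<⇒≢ t<N) | ≤ᵇ-false high = refl

    isHome-top : ∀ s → isHome n N s ≡ (if s ≤ᵇ M then false else true)
    isHome-top s rewrite ≡ᵇ-refl N = refl

    venue-home : ∀ t s → isHome n t s ≡ true → venue n t s ≡ t
    venue-home t s home rewrite home = refl

    -- In slot s, team t < N meets team (s + N - t) mod N, or team N when that residue is t itself.
    opponent-residue : ∀ t s → t ≤ N → ((s % N + N) ∸ t) % N ≡ (s + (N ∸ t)) % N
    opponent-residue t s t≤N = begin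
      ((s % N + N) ∸ t) % N             ≡⟨ cong (_% N) (+-∸-assoc (s % N) t≤N) ⟩
      (s % N + (N ∸ t)) % N             ≡⟨ %-distribˡ-+ (s % N) (N ∸ t) N ⟩
      (s % N % N + (N ∸ t) % N) % N     ≡⟨ cong (λ r → (r + (N ∸ t) % N) % N) (m%n%n≡m%n s N) ⟩
      (s % N + (N ∸ t) % N) % N         ≡⟨ %-distribˡ-+ s (N ∸ t) N ⟨
      (s + (N ∸ t)) % N                 ∎
      where open ≡-Reasoning

    opponent-low : ∀ t s → t < N →
      oppDRR n t s ≡ (if (s + (N ∸ t)) % N ≡ᵇ t then N else (s + (N ∸ t)) % N)
    opponent-low t s t<N rewrite ≡ᵇ-false (<⇒≢ t<N) | opponent-residue t s (<⇒≤ t<N) = refl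

    venue-away : ∀ t s x → t < N → isHome n t s ≡ false → (s + (N ∸ t)) % N ≡ x → x ≢ t → venue n t s ≡ x
    venue-away t s x t<N away res x≢t rewrite away | opponent-low t s t<N | res | ≡ᵇ-false x≢t = refl

    venue-away-top : ∀ t s → t < N → isHome n t s ≡ false → (s + (N ∸ t)) % N ≡ t → venue n t s ≡ N
    venue-away-top t s t<N away res rewrite away | opponent-low t s t<N | res | ≡ᵇ-refl t = refl

    mod-N : ∀ x k → x < N → (x + k * N) % N ≡ x
    mod-N x k x<N = trans ([m+kn]%n≡m%n x k N) (m<n⇒m%n≡m x<N)

    slot-count : 2 * n ∸ 2 ≡ N + N
    slot-count = trans (+-suc M (suc (M + 0))) (cong (λ m → suc (M + suc m)) (+-identityʳ M))

  -- A team t < n/2, written with n - 2 = 2t + R.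
  module LowTeam (t R : ℕ) where
    M : ℕ
    M = t + t + R
    open Schedule M

    double : 2 * t ≡ t + t
    double = cong (t +_) (+-identityʳ t)

    t<N : t < N
    t<N = s≤s (≤-trans (m≤m+n t t) (m≤m+n (t + t) R))

    low : suc t ≤ n / 2
    low = subst (_≤ n / 2) (m*n/n≡m (suc t) 2) (/-monoˡ-≤ 2 (≤-from-+ R e))
      where
      e : suc t * 2 + R ≡ suc (suc (t + t + R))
      e = ℕ-solve (t ∷ R ∷ [])

    N∸t : N ∸ t ≡ suc (t + R)
    N∸t = trans (cong (_∸ t) e) (m+n∸m≡n t (suc (t + R)))
      where
      e : suc (t + t + R) ≡ t + suc (t + R)
      e = ℕ-solve (t ∷ R ∷ [])

    isHome-at : ∀ s → isHome n t s ≡ between (2 * t) (M + 2 * t) s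
    isHome-at s = isHome-low t s t<N low

    venue-first : ∀ u → u < t → venue n t (0 + u) ≡ suc (t + R) + u
    venue-first u u<t = venue-away t u _ t<N away residue
        (>⇒≢ (s≤s (≤-trans (m≤m+n t R) (m≤m+n (t + R) u))))
      where
      away : isHome n t u ≡ false
      away rewrite isHome-at u | ≤ᵇ-false {2 * t} {u} (<-≤-trans u<t (≤-from-+ t (sym double))) = refl
      e : suc (t + R) + t ≡ suc (t + t + R)
      e = ℕ-solve (t ∷ R ∷ [])
      residue : (u + (N ∸ t)) % N ≡ suc (t + R) + u
      residue rewrite N∸t = trans (cong (_% N) (+-comm u (suc (t + R))))
        (m<n⇒m%n≡m (<-≤-trans (+-monoʳ-< (suc (t + R)) u<t) (≤-reflexive e)))

    venue-second : ∀ u → u < t → venue n t (t + u) ≡ 0 + u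
    venue-second u u<t = venue-away t (t + u) u t<N away residue (<⇒≢ u<t)
      where
      away : isHome n t (t + u) ≡ false
      away rewrite isHome-at (t + u) | ≤ᵇ-false {2 * t} {t + u} (<-≤-trans (+-monoʳ-< t u<t) (≤-reflexive (sym double))) = refl
      e : t + u + suc (t + R) ≡ u + 1 * suc (t + t + R)
      e = ℕ-solve (t ∷ R ∷ u ∷ [])
      residue : (t + u + (N ∸ t)) % N ≡ u
      residue rewrite N∸t = trans (cong (_% N) e) (mod-N u 1 (<-trans u<t t<N))

    venue-home-block : ∀ u → u < N → venue n t (t + t + u) ≡ t
    venue-home-block u u<N = venue-home t (t + t + u) home
      where
      e : t + t + (t + t + R) ≡ t + t + R + 2 * t
      e = ℕ-solve (t ∷ R ∷ [])
      home : isHome n t (t + t + u) ≡ true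
      home rewrite isHome-at (t + t + u) | ≤ᵇ-true {2 * t} {t + t + u} (≤-from-+ u (cong (_+ u) double))
                 | ≤ᵇ-true {t + t + u} {M + 2 * t} (≤-trans (+-monoʳ-≤ (t + t) (≤-pred u<N)) (≤-reflexive e)) = refl

    venue-top : venue n t (t + t + N) ≡ N
    venue-top = venue-away-top t (t + t + N) t<N away residue
      where
      e₁ : t + t + R + 2 * t + 1 ≡ t + t + suc (t + t + R)
      e₁ = ℕ-solve (t ∷ R ∷ [])
      away : isHome n t (t + t + N) ≡ false
      away rewrite isHome-at (t + t + N) | ≤ᵇ-true {2 * t} {t + t + N} (≤-from-+ N (cong (_+ N) double))
                 | ≤ᵇ-false {t + t + N} {M + 2 * t} (<-from-+ 0 e₁) = refl
      e₂ : t + t + suc (t + t + R) + suc (t + R) ≡ t + 2 * suc (t + t + R)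
      e₂ = ℕ-solve (t ∷ R ∷ [])
      residue : (t + t + N + (N ∸ t)) % N ≡ t
      residue rewrite N∸t = trans (cong (_% N) e₂) (mod-N t 2 t<N)

    venue-last : ∀ u → u < R → venue n t (t + t + N + 1 + u) ≡ suc t + u
    venue-last u u<R = venue-away t (t + t + N + 1 + u) (suc t + u) t<N away residue (>⇒≢ (s≤s (m≤m+n t u)))
      where
      e₁ : 2 * t + (suc (t + t + R) + 1 + u) ≡ t + t + suc (t + t + R) + 1 + u
      e₁ = ℕ-solve (t ∷ R ∷ u ∷ [])
      e₂ : t + t + R + 2 * t + suc (suc u) ≡ t + t + suc (t + t + R) + 1 + u
      e₂ = ℕ-solve (t ∷ R ∷ u ∷ [])
      away : isHome n t (t + t + N + 1 + u) ≡ false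
      away rewrite isHome-at (t + t + N + 1 + u) | ≤ᵇ-true {2 * t} {t + t + N + 1 + u} (≤-from-+ (N + 1 + u) e₁)
                 | ≤ᵇ-false {t + t + N + 1 + u} {M + 2 * t} (<-from-+ (suc u) e₂) = refl
      e₃ : t + t + suc (t + t + R) + 1 + u + suc (t + R) ≡ (suc t + u) + 2 * suc (t + t + R)
      e₃ = ℕ-solve (t ∷ R ∷ u ∷ [])
      e₄ : suc t + R + t ≡ suc (t + t + R)
      e₄ = ℕ-solve (t ∷ R ∷ [])
      residue : (t + t + N + 1 + u + (N ∸ t)) % N ≡ suc t + u
      residue rewrite N∸t = trans (cong (_% N) e₃)
        (mod-N (suc t + u) 2 (<-≤-trans (+-monoʳ-< (suc t) u<R) (≤-from-+ t e₄)))

    slots : 2 * n ∸ 2 ≡ t + (t + (N + (1 + R)))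
    slots = trans slot-count e
      where
      e : suc (t + t + R) + suc (t + t + R) ≡ t + (t + (suc (t + t + R) + (1 + R)))
      e = ℕ-solve (t ∷ R ∷ [])

    low-venues : map (venue n t) (range 0 (2 * n ∸ 2))
               ≡ range (suc (t + R)) t ++ range 0 t ++ replicate N t ++ N ∷ range (suc t) R
    low-venues = begin
      map f (range 0 (2 * n ∸ 2))                    ≡⟨ cong (map f ∘ range 0) slots ⟩
      map f (range 0 (t + (t + (N + (1 + R)))))      ≡⟨ map-range-++ f 0 t _ ⟩
      map f (range 0 t) ++ map f (range t (t + (N + (1 + R))))
        ≡⟨ cong₂ _++_ (map-range-translate f 0 _ t venue-first)
          (trans (map-range-++ f t t _) (cong₂ _++_ (map-range-translate f t 0 t venue-second)
          (trans (map-range-++ f (t + t) N _) (cong₂ _++_ (map-range-const f (t + t) t N venue-home-block)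
          (trans (map-range-++ f (t + t + N) 1 R) (cong₂ _++_ (cong (_∷ []) venue-top)
            (map-range-translate f (t + t + N + 1) (suc t) R venue-last))))))) ⟩
      range (suc (t + R)) t ++ range 0 t ++ replicate N t ++ N ∷ range (suc t) R ∎
      where
      open ≡-Reasoning
      f : ℕ → ℕ
      f = venue n t

  -- A team n/2 ≤ t ≤ n - 2, written with t = Q + P' + 1 and n - 2 = t + Q.
  module HighTeam (Q P' : ℕ) where
    t : ℕ
    t = Q + suc P'
    M : ℕ
    M = t + Q
    open Schedule M

    t<N : t < N
    t<N = s≤s (m≤m+n t Q)

    high : n / 2 < suc t
    high = m<n*o⇒m/o<n {n} {suc t} {2} (<-from-+ P' e)
      where
      e : suc (suc (Q + suc P' + Q)) + suc P' ≡ suc (Q + suc P') * 2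
      e = ℕ-solve (Q ∷ P' ∷ [])

    away-from : 2 * t + 2 ∸ n ≡ suc P'
    away-from = trans (cong (_∸ n) e) (m+n∸n≡m (suc P') n)
      where
      e : 2 * (Q + suc P') + 2 ≡ suc P' + suc (suc (Q + suc P' + Q))
      e = ℕ-solve (Q ∷ P' ∷ [])

    N∸t : N ∸ t ≡ suc Q
    N∸t = trans (cong (_∸ t) e) (m+n∸m≡n t (suc Q))
      where
      e : suc (Q + suc P' + Q) ≡ (Q + suc P') + suc Q
      e = ℕ-solve (Q ∷ P' ∷ [])

    isHome-at : ∀ s → isHome n t s ≡ (if between (suc P') (2 * t) s then false else true)
    isHome-at s = trans (isHome-high t s t<N high) (cong (λ a → if between a (2 * t) s then false else true) away-from)

    2t≡ : suc P' + Q + (Q + suc P') ≡ 2 * (Q + suc P')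
    2t≡ = ℕ-solve (Q ∷ P' ∷ [])

    venue-first : ∀ u → u < suc P' → venue n t (0 + u) ≡ t
    venue-first u u<P = venue-home t u home
      where
      home : isHome n t u ≡ true
      home rewrite isHome-at u | ≤ᵇ-false {suc P'} {u} u<P = refl

    venue-second : ∀ u → u < Q → venue n t (suc P' + u) ≡ suc t + u
    venue-second u u<Q = venue-away t (suc P' + u) (suc t + u) t<N away residue (>⇒≢ (s≤s (m≤m+n t u)))
      where
      away : isHome n t (suc P' + u) ≡ false
      away rewrite isHome-at (suc P' + u) | ≤ᵇ-true {suc P'} {suc P' + u} (m≤m+n (suc P') u)
                 | ≤ᵇ-true {suc P' + u} {2 * t} (≤-trans (+-monoʳ-≤ (suc P') (<⇒≤ u<Q)) (≤-from-+ t 2t≡)) = refl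
      e : suc P' + u + suc Q ≡ (suc (Q + suc P') + u) + 0 * suc (Q + suc P' + Q)
      e = ℕ-solve (Q ∷ P' ∷ u ∷ [])
      residue : (suc P' + u + (N ∸ t)) % N ≡ suc t + u
      residue rewrite N∸t = trans (cong (_% N) e) (mod-N (suc t + u) 0 (s≤s (+-monoʳ-< t u<Q)))

    venue-third : ∀ u → u < t → venue n t (suc P' + Q + u) ≡ 0 + u
    venue-third u u<t = venue-away t (suc P' + Q + u) u t<N away residue (<⇒≢ u<t)
      where
      away : isHome n t (suc P' + Q + u) ≡ false
      away rewrite isHome-at (suc P' + Q + u) | ≤ᵇ-true {suc P'} {suc P' + Q + u} (≤-from-+ (Q + u) (sym (+-assoc (suc P') Q u)))
                 | ≤ᵇ-true {suc P' + Q + u} {2 * t} (≤-trans (+-monoʳ-≤ (suc P' + Q) (<⇒≤ u<t)) (≤-reflexive 2t≡)) = refl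
      e : suc P' + Q + u + suc Q ≡ u + 1 * suc (Q + suc P' + Q)
      e = ℕ-solve (Q ∷ P' ∷ u ∷ [])
      residue : (suc P' + Q + u + (N ∸ t)) % N ≡ u
      residue rewrite N∸t = trans (cong (_% N) e) (mod-N u 1 (<-trans u<t t<N))

    venue-top : venue n t (suc P' + Q + t) ≡ N
    venue-top = venue-away-top t (suc P' + Q + t) t<N away residue
      where
      away : isHome n t (suc P' + Q + t) ≡ false
      away rewrite isHome-at (suc P' + Q + t) | ≤ᵇ-true {suc P'} {suc P' + Q + t} (≤-from-+ (Q + t) (sym (+-assoc (suc P') Q t)))
                 | ≤ᵇ-true {suc P' + Q + t} {2 * t} (≤-reflexive 2t≡) = refl
      e : suc P' + Q + (Q + suc P') + suc Q ≡ (Q + suc P') + 1 * suc (Q + suc P' + Q)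
      e = ℕ-solve (Q ∷ P' ∷ [])
      residue : (suc P' + Q + t + (N ∸ t)) % N ≡ t
      residue rewrite N∸t = trans (cong (_% N) e) (mod-N t 1 t<N)

    venue-last : ∀ u → u < suc (Q + Q) → venue n t (suc P' + Q + t + 1 + u) ≡ t
    venue-last u _ = venue-home t (suc P' + Q + t + 1 + u) home
      where
      e₁ : suc P' + (Q + (Q + suc P') + 1 + u) ≡ suc P' + Q + (Q + suc P') + 1 + u
      e₁ = ℕ-solve (Q ∷ P' ∷ u ∷ [])
      e₂ : 2 * (Q + suc P') + suc u ≡ suc P' + Q + (Q + suc P') + 1 + u
      e₂ = ℕ-solve (Q ∷ P' ∷ u ∷ [])
      home : isHome n t (suc P' + Q + t + 1 + u) ≡ true
      home rewrite isHome-at (suc P' + Q + t + 1 + u)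
                 | ≤ᵇ-true {suc P'} {suc P' + Q + t + 1 + u} (≤-from-+ (Q + t + 1 + u) e₁)
                 | ≤ᵇ-false {suc P' + Q + t + 1 + u} {2 * t} (<-from-+ u e₂) = refl

    slots : 2 * n ∸ 2 ≡ suc P' + (Q + (t + (1 + suc (Q + Q))))
    slots = trans slot-count e
      where
      e : suc (Q + suc P' + Q) + suc (Q + suc P' + Q) ≡ suc P' + (Q + ((Q + suc P') + (1 + suc (Q + Q))))
      e = ℕ-solve (Q ∷ P' ∷ [])

    high-venues : map (venue n t) (range 0 (2 * n ∸ 2))
                ≡ replicate (suc P') t ++ range (suc t) Q ++ range 0 t ++ N ∷ replicate (suc (Q + Q)) t
    high-venues = begin
      map f (range 0 (2 * n ∸ 2))                               ≡⟨ cong (map f ∘ range 0) slots ⟩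
      map f (range 0 (suc P' + (Q + (t + (1 + suc (Q + Q))))))  ≡⟨ map-range-++ f 0 (suc P') _ ⟩
      map f (range 0 (suc P')) ++ map f (range (suc P') (Q + (t + (1 + suc (Q + Q)))))
        ≡⟨ cong₂ _++_ (map-range-const f 0 t (suc P') venue-first)
          (trans (map-range-++ f (suc P') Q _) (cong₂ _++_ (map-range-translate f (suc P') (suc t) Q venue-second)
          (trans (map-range-++ f (suc P' + Q) t _) (cong₂ _++_ (map-range-translate f (suc P' + Q) 0 t venue-third)
          (trans (map-range-++ f (suc P' + Q + t) 1 _) (cong₂ _++_ (cong (_∷ []) venue-top)
            (map-range-const f (suc P' + Q + t + 1) t _ venue-last))))))) ⟩
      replicate (suc P') t ++ range (suc t) Q ++ range 0 t ++ N ∷ replicate (suc (Q + Q)) t ∎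
      where
      open ≡-Reasoning
      f : ℕ → ℕ
      f = venue n t

  module TopTeam (M : ℕ) where
    open Schedule M

    top-venues : map (venue n N) (range 0 (2 * n ∸ 2)) ≡ map (oppDRR n N) (range 0 N) ++ replicate N N
    top-venues = begin
      map (venue n N) (range 0 (2 * n ∸ 2))        ≡⟨ cong (map (venue n N) ∘ range 0) slot-count ⟩
      map (venue n N) (range 0 (N + N))            ≡⟨ map-range-++ (venue n N) 0 N N ⟩
      map (venue n N) (range 0 N) ++ map (venue n N) (range N N)
                                                   ≡⟨ cong₂ _++_ (map-range-shift (venue n N) (oppDRR n N) 0 0 N first-half)
                                                                 (map-range-const (venue n N) N N N second-half) ⟩
      map (oppDRR n N) (range 0 N) ++ replicate N N ∎
      where
      open ≡-Reasoning
      first-half : ∀ u → u < N → venue n N (0 + u) ≡ oppDRR n N (0 + u)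
      first-half u u<N rewrite isHome-top u | ≤ᵇ-true (≤-pred u<N) = refl
      second-half : ∀ u → u < N → venue n N (N + u) ≡ N
      second-half u _ rewrite isHome-top (N + u) | ≤ᵇ-false {N + u} {M} (s≤s (m≤m+n M u)) = refl

open import Data.Integer using (+_)
open import Data.Fin using (Fin; toℕ)
import Data.Fin.Properties as Fin
open import Data.Fin.Permutation using (Permutation′; _⟨$⟩ʳ_; _⟨$⟩ˡ_; inverseʳ)
open import Data.Rational using (ℚ; 0ℚ; _+_; _-_; _*_; _≤_; _/_; ½; toℚᵘ)
import Data.Rational.Properties as ℚ
open import Data.Rational.Solver using (module +-*-Solver)
open import Data.Rational.Unnormalised as ℚᵘ using (mkℚᵘ; *≡*)
import Data.Rational.Unnormalised.Properties as ℚᵘ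
open import Data.Integer.Solver renaming (module +-*-Solver to ℤ-Solver)
open Venues using (module Schedule; module LowTeam; module HighTeam; module TopTeam)

½-+-half : ∀ k → ½ + (+ k) / 2 ≡ (+ suc k) / 2
½-+-half k = ℚ.toℚᵘ-injective (begin
  toℚᵘ (½ + (+ k) / 2)                       ≈⟨ ℚ.toℚᵘ-homo-+ ½ ((+ k) / 2) ⟩
  toℚᵘ ½ ℚᵘ.+ toℚᵘ ((+ k) / 2)               ≈⟨ ℚᵘ.+-cong (ℚ.toℚᵘ-fromℚᵘ (mkℚᵘ (+ 1) 1)) (ℚ.toℚᵘ-fromℚᵘ (mkℚᵘ (+ k) 1)) ⟩
  mkℚᵘ (+ 1) 1 ℚᵘ.+ mkℚᵘ (+ k) 1             ≈⟨ *≡* (solve 1 (λ x → (con (+ 1) :* con (+ 2) :+ x :* con (+ 2)) :* con (+ 2) := (con (+ 1) :+ x) :* (con (+ 2) :* con (+ 2))) refl (+ k)) ⟩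
  mkℚᵘ (+ suc k) 1                           ≈⟨ ℚ.toℚᵘ-fromℚᵘ (mkℚᵘ (+ suc k) 1) ⟨
  toℚᵘ ((+ suc k) / 2)                       ∎)
  where
  open ℚᵘ.≃-Reasoning
  open ℤ-Solver

half-step : ∀ k τ → ½ * τ + ((+ k) / 2) * τ ≡ ((+ suc k) / 2) * τ
half-step k τ = trans (sym (ℚ.*-distribʳ-+ τ ½ ((+ k) / 2))) (cong (_* τ) (½-+-half k))

halve : ∀ x τ → x + x ≤ τ → x ≤ ½ * τ
halve x τ x+x≤τ = ℚ.≤-trans (ℚ.≤-reflexive x≡) (ℚ.*-monoˡ-≤-nonNeg ½ x+x≤τ)
  where
  open +-*-Solver
  x≡ : x ≡ ½ * (x + x)
  x≡ = solve 1 (λ y → y := con ½ :* (y :+ y)) refl x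

x+c≡y⇒x≤y-c : ∀ x c y → x + c ≡ y → x ≤ y - c
x+c≡y⇒x≤y-c x c y x+c≡y = ℚ.≤-reflexive (trans (solve 2 (λ a b → a := (a :+ b) :- b) refl x c) (cong (_- c) x+c≡y))
  where open +-*-Solver

module Cycles {V : Set} (δ : V → V → ℚ) where

  path : V → List V → ℚ
  path x []       = 0ℚ
  path x (y ∷ ys) = δ x y + path y ys

  endpoint : V → List V → V
  endpoint x []       = x
  endpoint x (y ∷ ys) = endpoint y ys

  cyc : List V → ℚ
  cyc []       = 0ℚ
  cyc (x ∷ xs) = path x (xs ++ x ∷ [])

  path-++ : ∀ x ys zs → path x (ys ++ zs) ≡ path x ys + path (endpoint x ys) zs
  path-++ x []       zs = sym (ℚ.+-identityˡ _)
  path-++ x (y ∷ ys) zs = begin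
    δ x y + path y (ys ++ zs)                          ≡⟨ cong (λ q → δ x y + q) (path-++ y ys zs) ⟩
    δ x y + (path y ys + path (endpoint y ys) zs)      ≡⟨ ℚ.+-assoc (δ x y) _ _ ⟨
    δ x y + path y ys + path (endpoint y ys) zs        ∎
    where open ≡-Reasoning

  path-snoc : ∀ x ys z → path x (ys ++ z ∷ []) ≡ path x ys + δ (endpoint x ys) z
  path-snoc x ys z = trans (path-++ x ys (z ∷ [])) (cong (λ q → path x ys + q) (ℚ.+-identityʳ _))

  cyc-split : ∀ x xs y ys →
    cyc ((x ∷ xs) ++ y ∷ ys) ≡ path x xs + δ (endpoint x xs) y + (path y ys + δ (endpoint y ys) x)
  cyc-split x xs y ys = begin
    path x ((xs ++ y ∷ ys) ++ x ∷ [])                 ≡⟨ cong (path x) (++-assoc xs (y ∷ ys) (x ∷ [])) ⟩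
    path x (xs ++ y ∷ (ys ++ x ∷ []))                 ≡⟨ path-++ x xs _ ⟩
    path x xs + (δ (endpoint x xs) y + path y (ys ++ x ∷ []))
                                                      ≡⟨ cong (λ q → path x xs + (δ (endpoint x xs) y + q)) (path-snoc y ys x) ⟩
    path x xs + (δ (endpoint x xs) y + (path y ys + δ (endpoint y ys) x))
                                                      ≡⟨ ℚ.+-assoc (path x xs) _ _ ⟨
    path x xs + δ (endpoint x xs) y + (path y ys + δ (endpoint y ys) x) ∎
    where open ≡-Reasoning

  cyc-rotate : ∀ xs ys → cyc (xs ++ ys) ≡ cyc (ys ++ xs)
  cyc-rotate []       ys       = cong cyc (sym (++-identityʳ ys))
  cyc-rotate (x ∷ xs) []       = cong cyc (++-identityʳ (x ∷ xs))
  cyc-rotate (x ∷ xs) (y ∷ ys) = begin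
    cyc ((x ∷ xs) ++ y ∷ ys)                                              ≡⟨ cyc-split x xs y ys ⟩
    path x xs + δ (endpoint x xs) y + (path y ys + δ (endpoint y ys) x)   ≡⟨ ℚ.+-comm (path x xs + δ (endpoint x xs) y) _ ⟩
    path y ys + δ (endpoint y ys) x + (path x xs + δ (endpoint x xs) y)   ≡⟨ cyc-split y ys x xs ⟨
    cyc ((y ∷ ys) ++ x ∷ xs)                                              ∎
    where open ≡-Reasoning

  cyc-detour : ∀ xs a x b ys →
    cyc (xs ++ a ∷ x ∷ b ∷ ys) + δ a b ≡ cyc (xs ++ a ∷ b ∷ ys) + δ a x + δ x b
  cyc-detour xs a x b ys = begin
    cyc (xs ++ a ∷ x ∷ b ∷ ys) + δ a b          ≡⟨ cong (_+ δ a b) (cyc-rotate xs _) ⟩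
    δ a x + (δ x b + W) + δ a b                  ≡⟨ +-*-Solver.solve 4 (λ p q r w → p :+ (q :+ w) :+ r := r :+ w :+ p :+ q) refl (δ a x) (δ x b) (δ a b) W ⟩
    δ a b + W + δ a x + δ x b                    ≡⟨ cong (λ q → q + δ a x + δ x b) (cyc-rotate xs (a ∷ b ∷ ys)) ⟨
    cyc (xs ++ a ∷ b ∷ ys) + δ a x + δ x b       ∎
    where
    open ≡-Reasoning
    open +-*-Solver using (_:+_; _:=_)
    W : ℚ
    W = path b ((ys ++ xs) ++ a ∷ [])

  module _ (δ-refl : ∀ x → δ x x ≡ 0ℚ) where

    path-stay : ∀ x k zs → path x (replicate k x ++ zs) ≡ path x zs
    path-stay x zero    zs = refl
    path-stay x (suc k) zs = begin
      δ x x + path x (replicate k x ++ zs)  ≡⟨ cong (λ q → q + path x (replicate k x ++ zs)) (δ-refl x) ⟩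
      0ℚ + path x (replicate k x ++ zs)     ≡⟨ ℚ.+-identityˡ _ ⟩
      path x (replicate k x ++ zs)          ≡⟨ path-stay x k zs ⟩
      path x zs                             ∎
      where open ≡-Reasoning

    cyc-stay : ∀ xs k a ys → cyc (xs ++ replicate (suc k) a ++ ys) ≡ cyc (xs ++ a ∷ ys)
    cyc-stay xs k a ys = begin
      cyc (xs ++ replicate (suc k) a ++ ys)        ≡⟨ cyc-rotate xs _ ⟩
      cyc ((replicate (suc k) a ++ ys) ++ xs)      ≡⟨ cong cyc (++-assoc (replicate (suc k) a) ys xs) ⟩
      path a ((replicate k a ++ ys ++ xs) ++ a ∷ [])  ≡⟨ cong (path a) (++-assoc (replicate k a) _ _) ⟩
      path a (replicate k a ++ (ys ++ xs) ++ a ∷ [])  ≡⟨ path-stay a k _ ⟩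
      cyc (a ∷ ys ++ xs)                           ≡⟨ cyc-rotate (a ∷ ys) xs ⟩
      cyc (xs ++ a ∷ ys)                           ∎
      where open ≡-Reasoning

  module _ (δ-nonneg : ∀ x y → 0ℚ ≤ δ x y) (δ-refl : ∀ x → δ x x ≡ 0ℚ)
           (δ-tri : ∀ x y z → δ x z ≤ δ x y + δ y z) where

    path-nonneg : ∀ x ys → 0ℚ ≤ path x ys
    path-nonneg x []       = ℚ.≤-refl
    path-nonneg x (y ∷ ys) = ℚ.+-mono-≤ (δ-nonneg x y) (path-nonneg y ys)

    direct-≤-walk : ∀ x ys z → δ x z ≤ path x ys + δ (endpoint x ys) z
    direct-≤-walk x []       z = ℚ.≤-reflexive (sym (ℚ.+-identityˡ (δ x z)))
    direct-≤-walk x (y ∷ ys) z = begin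
      δ x z                                        ≤⟨ δ-tri x y z ⟩
      δ x y + δ y z                                ≤⟨ ℚ.+-monoʳ-≤ (δ x y) (direct-≤-walk y ys z) ⟩
      δ x y + (path y ys + δ (endpoint y ys) z)    ≡⟨ ℚ.+-assoc (δ x y) _ _ ⟨
      δ x y + path y ys + δ (endpoint y ys) z      ∎
      where open ℚ.≤-Reasoning

    round-trip-≤-cyc : ∀ {a b} l → a ∈ l → b ∈ l → δ a b + δ b a ≤ cyc l
    round-trip-≤-cyc {a} {b} l a∈l b∈l with ∈-∃++ a∈l
    ... | us , vs , refl =
      ℚ.≤-trans (from-head (move (∈-++⁻ us b∈l))) (ℚ.≤-reflexive (cyc-rotate (a ∷ vs) us))
      where
      move : b ∈ us ⊎ b ∈ a ∷ vs → b ∈ a ∷ (vs ++ us)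
      move (inj₁ b∈us)         = there (∈-++⁺ʳ vs b∈us)
      move (inj₂ (here b≡a))   = here b≡a
      move (inj₂ (there b∈vs)) = there (∈-++⁺ˡ b∈vs)
      from-head : ∀ {a b zs} → b ∈ a ∷ zs → δ a b + δ b a ≤ cyc (a ∷ zs)
      from-head {a} {zs = zs} (here refl) = begin
        δ a a + δ a a      ≡⟨ cong₂ _+_ (δ-refl a) (δ-refl a) ⟩
        0ℚ                 ≤⟨ path-nonneg a (zs ++ a ∷ []) ⟩
        cyc (a ∷ zs)       ∎
        where open ℚ.≤-Reasoning
      from-head {a} {b} (there b∈zs) with ∈-∃++ b∈zs
      ... | ps , qs , refl = begin
        δ a b + δ b a                                                          ≤⟨ ℚ.+-mono-≤ (direct-≤-walk a ps b) (direct-≤-walk b qs a) ⟩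
        path a ps + δ (endpoint a ps) b + (path b qs + δ (endpoint b qs) a)    ≡⟨ cyc-split a ps b qs ⟨
        cyc (a ∷ ps ++ b ∷ qs)                                                 ∎
        where open ℚ.≤-Reasoning

  path-≤-half : ∀ τ → (∀ x y → δ x y ≤ ½ * τ) → ∀ x ys → path x ys ≤ ((+ length ys) / 2) * τ
  path-≤-half τ short x []       = ℚ.≤-reflexive (sym (ℚ.*-zeroˡ τ))
  path-≤-half τ short x (y ∷ ys) = begin
    δ x y + path y ys                          ≤⟨ ℚ.+-mono-≤ (short x y) (path-≤-half τ short y ys) ⟩
    ½ * τ + ((+ length ys) / 2) * τ            ≡⟨ half-step (length ys) τ ⟩
    ((+ suc (length ys)) / 2) * τ              ∎
    where open ℚ.≤-Reasoning

  cyc-≤-half : ∀ τ → (∀ x y → δ x y ≤ ½ * τ) → ∀ l → cyc l ≤ ((+ length l) / 2) * τ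
  cyc-≤-half τ short []       = ℚ.≤-reflexive (sym (ℚ.*-zeroˡ τ))
  cyc-≤-half τ short (x ∷ xs) = ℚ.≤-trans (path-≤-half τ short x (xs ++ x ∷ []))
    (ℚ.≤-reflexive (cong (λ k → ((+ k) / 2) * τ) (trans (length-++-sucʳ xs x []) (cong (suc ∘ length) (++-identityʳ xs)))))

sumTo-cong : ∀ k (f g : ℕ → ℚ) → (∀ s → s <ℕ k → f s ≡ g s) → sumTo k f ≡ sumTo k g
sumTo-cong zero    f g eq = refl
sumTo-cong (suc k) f g eq = cong₂ _+_ (sumTo-cong k f g (λ s s<k → eq s (ℕ.m≤n⇒m≤1+n s<k))) (eq k ℕ.≤-refl)

module SumsAsWalks {V : Set} (δ : V → V → ℚ) (w : ℕ → V) where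
  open Cycles δ

  endpoint-range : ∀ a k → endpoint (w a) (map w (range (suc a) k)) ≡ w (a ℕ.+ k)
  endpoint-range a zero    = cong w (sym (ℕ.+-identityʳ a))
  endpoint-range a (suc k) = trans (endpoint-range (suc a) k) (cong w (sym (ℕ.+-suc a k)))

  sum-as-path : ∀ K → sumTo K (λ s → δ (w s) (w (suc s))) ≡ path (w 0) (map w (range 1 K))
  sum-as-path zero    = refl
  sum-as-path (suc K) = begin
    sumTo K (λ s → δ (w s) (w (suc s))) + δ (w K) (w (suc K))                  ≡⟨ cong₂ _+_ (sum-as-path K) (cong (λ v → δ v (w (suc K))) (sym (endpoint-range 0 K))) ⟩
    path (w 0) (map w (range 1 K)) + δ (endpoint (w 0) (map w (range 1 K))) (w (suc K))
                                                                               ≡⟨ path-snoc (w 0) (map w (range 1 K)) (w (suc K)) ⟨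
    path (w 0) (map w (range 1 K) ++ w (suc K) ∷ [])                           ≡⟨ cong (path (w 0)) (map-++ w (range 1 K) (suc K ∷ [])) ⟨
    path (w 0) (map w (range 1 K ++ suc K ∷ []))                               ≡⟨ cong (path (w 0) ∘ map w) (range-snoc 1 K) ⟨
    path (w 0) (map w (range 1 (suc K)))                                       ∎
    where open ≡-Reasoning

  sum-as-cyc : ∀ L K → L ≡ suc K → sumTo L (λ s → δ (w s) (w (suc s mod L))) ≡ cyc (map w (range 0 L))
  sum-as-cyc .(suc K) K refl = begin
    sumTo K (λ s → δ (w s) (w (suc s mod suc K))) + δ (w K) (w (suc K mod suc K))
                                  ≡⟨ cong₂ _+_ (sumTo-cong K _ _ (λ s s<K → cong (δ (w s) ∘ w) (m<n⇒m%n≡m (s≤s s<K))))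
                                               (cong (δ (w K) ∘ w) (n%n≡0 (suc K))) ⟩
    sumTo K (λ s → δ (w s) (w (suc s))) + δ (w K) (w 0)
                                  ≡⟨ cong₂ _+_ (sum-as-path K) (cong (λ v → δ v (w 0)) (sym (endpoint-range 0 K))) ⟩
    path (w 0) (map w (range 1 K)) + δ (endpoint (w 0) (map w (range 1 K))) (w 0)
                                  ≡⟨ path-snoc (w 0) (map w (range 1 K)) (w 0) ⟨
    cyc (map w (range 0 (suc K))) ∎
    where open ≡-Reasoning

replicate-++ : ∀ {A : Set} i j (x : A) → replicate i x ++ replicate j x ≡ replicate (i ℕ.+ j) x
replicate-++ zero    j x = refl
replicate-++ (suc i) j x = cong (x ∷_) (replicate-++ i j x)

module Tours (δ : ℕ → ℕ → ℚ) (δ-refl : ∀ x → δ x x ≡ 0ℚ) where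
  open Cycles δ

  detour-tour : ∀ a X i j k →
    cyc (range 0 a ++ replicate (suc i) a ++ X ∷ replicate (suc j) (suc a) ++ range (suc (suc a)) k) + δ a (suc a)
      ≡ cyc (range 0 (a ℕ.+ suc (suc k))) + δ a X + δ X (suc a)
  detour-tour a X i j k = begin
    cyc (range 0 a ++ replicate (suc i) a ++ X ∷ replicate (suc j) (suc a) ++ rest) + δ a (suc a)
      ≡⟨ cong (_+ δ a (suc a)) (cyc-stay δ-refl (range 0 a) i a _) ⟩
    cyc (range 0 a ++ a ∷ X ∷ replicate (suc j) (suc a) ++ rest) + δ a (suc a)
      ≡⟨ cong (λ l → cyc l + δ a (suc a)) (++-assoc (range 0 a) (a ∷ X ∷ []) _) ⟨
    cyc ((range 0 a ++ a ∷ X ∷ []) ++ replicate (suc j) (suc a) ++ rest) + δ a (suc a)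
      ≡⟨ cong (_+ δ a (suc a)) (cyc-stay δ-refl (range 0 a ++ a ∷ X ∷ []) j (suc a) rest) ⟩
    cyc ((range 0 a ++ a ∷ X ∷ []) ++ suc a ∷ rest) + δ a (suc a)
      ≡⟨ cong (λ l → cyc l + δ a (suc a)) (++-assoc (range 0 a) (a ∷ X ∷ []) _) ⟩
    cyc (range 0 a ++ a ∷ X ∷ suc a ∷ rest) + δ a (suc a)
      ≡⟨ cyc-detour (range 0 a) a X (suc a) rest ⟩
    cyc (range 0 a ++ range a (suc (suc k))) + δ a X + δ X (suc a)
      ≡⟨ cong (λ l → cyc l + δ a X + δ X (suc a)) (range-++ 0 a (suc (suc k))) ⟨
    cyc (range 0 (a ℕ.+ suc (suc k))) + δ a X + δ X (suc a) ∎
    where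
    open ≡-Reasoning
    rest : List ℕ
    rest = range (suc (suc a)) k

  -- The walk of a team t < n/2 (N = n - 1 = 2t + R + 1) is the tour detoured via N between t and t+1.
  low-tour : ∀ t R k → R ℕ.+ t ≡ suc k →
    cyc (range (suc (t ℕ.+ R)) t ++ range 0 t ++ replicate (suc (t ℕ.+ t ℕ.+ R)) t ++ suc (t ℕ.+ t ℕ.+ R) ∷ range (suc t) R)
      + δ t (suc t)
      ≡ cyc (range 0 (suc (t ℕ.+ t ℕ.+ R))) + δ t (suc (t ℕ.+ t ℕ.+ R)) + δ (suc (t ℕ.+ t ℕ.+ R)) (suc t)
  low-tour t R k R+t≡ = begin
    cyc (A ++ B) + δ t (suc t)                   ≡⟨ cong (_+ δ t (suc t)) (cyc-rotate A B) ⟩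
    cyc (B ++ A) + δ t (suc t)                   ≡⟨ cong (λ l → cyc l + δ t (suc t)) B++A ⟩
    cyc (range 0 t ++ replicate N t ++ N ∷ range (suc t) (suc k)) + δ t (suc t)
                                                 ≡⟨ detour-tour t N (t ℕ.+ t ℕ.+ R) 0 k ⟩
    cyc (range 0 (t ℕ.+ suc (suc k))) + δ t N + δ N (suc t)
                                                 ≡⟨ cong (λ m → cyc (range 0 m) + δ t N + δ N (suc t)) size ⟩
    cyc (range 0 N) + δ t N + δ N (suc t)        ∎
    where
    open ≡-Reasoning
    N : ℕ
    N = suc (t ℕ.+ t ℕ.+ R)
    A : List ℕ
    A = range (suc (t ℕ.+ R)) t
    B : List ℕ
    B = range 0 t ++ replicate N t ++ N ∷ range (suc t) R
    B++A : B ++ A ≡ range 0 t ++ replicate N t ++ N ∷ range (suc t) (suc k)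
    B++A = begin
      B ++ A                                                        ≡⟨ ++-assoc (range 0 t) _ A ⟩
      range 0 t ++ (replicate N t ++ N ∷ range (suc t) R) ++ A      ≡⟨ cong (range 0 t ++_) (++-assoc (replicate N t) _ A) ⟩
      range 0 t ++ replicate N t ++ N ∷ range (suc t) R ++ A        ≡⟨ cong (λ l → range 0 t ++ replicate N t ++ N ∷ l) (range-++ (suc t) R t) ⟨
      range 0 t ++ replicate N t ++ N ∷ range (suc t) (R ℕ.+ t)     ≡⟨ cong (λ m → range 0 t ++ replicate N t ++ N ∷ range (suc t) m) R+t≡ ⟩
      range 0 t ++ replicate N t ++ N ∷ range (suc t) (suc k)       ∎
    size : t ℕ.+ suc (suc k) ≡ N
    size = trans (cong (λ m → t ℕ.+ suc m) (sym R+t≡)) rearrange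
      where
      rearrange : t ℕ.+ suc (R ℕ.+ t) ≡ suc (t ℕ.+ t ℕ.+ R)
      rearrange = ℕ-solve (t ∷ R ∷ [])

  -- The walk of a team t = T + 1 ≥ n/2 (N = t + Q + 1) is the tour detoured via N between T and t.
  high-tour : ∀ t T Q j X m → t ≡ suc T →
    cyc (replicate (suc j) t ++ range (suc t) Q ++ range 0 t ++ X ∷ replicate (suc m) t) + δ T t
      ≡ cyc (range 0 (T ℕ.+ suc (suc Q))) + δ T X + δ X t
  high-tour .(suc T) T Q j X m refl = begin
    cyc (replicate (suc j) (suc T) ++ range (suc (suc T)) Q ++ B) + δ T (suc T)
                                                 ≡⟨ cong (λ l → cyc l + δ T (suc T)) (++-assoc (replicate (suc j) (suc T)) _ B) ⟨
    cyc (A ++ B) + δ T (suc T)                   ≡⟨ cong (_+ δ T (suc T)) (cyc-rotate A B) ⟩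
    cyc (B ++ A) + δ T (suc T)                   ≡⟨ cong (λ l → cyc l + δ T (suc T)) B++A ⟩
    cyc (range 0 T ++ replicate 1 T ++ X ∷ replicate (suc (m ℕ.+ suc j)) (suc T) ++ range (suc (suc T)) Q) + δ T (suc T)
                                                 ≡⟨ detour-tour T X 0 (m ℕ.+ suc j) Q ⟩
    cyc (range 0 (T ℕ.+ suc (suc Q))) + δ T X + δ X (suc T) ∎
    where
    open ≡-Reasoning
    A : List ℕ
    A = replicate (suc j) (suc T) ++ range (suc (suc T)) Q
    B : List ℕ
    B = range 0 (suc T) ++ X ∷ replicate (suc m) (suc T)
    B++A : B ++ A ≡ range 0 T ++ replicate 1 T ++ X ∷ replicate (suc (m ℕ.+ suc j)) (suc T) ++ range (suc (suc T)) Q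
    B++A = begin
      B ++ A                                                              ≡⟨ cong (λ l → (l ++ X ∷ replicate (suc m) (suc T)) ++ A) (range-snoc 0 T) ⟩
      ((range 0 T ++ T ∷ []) ++ X ∷ replicate (suc m) (suc T)) ++ A       ≡⟨ cong (_++ A) (++-assoc (range 0 T) (T ∷ []) _) ⟩
      (range 0 T ++ T ∷ X ∷ replicate (suc m) (suc T)) ++ A               ≡⟨ ++-assoc (range 0 T) _ A ⟩
      range 0 T ++ T ∷ X ∷ replicate (suc m) (suc T) ++ A                 ≡⟨ cong (λ l → range 0 T ++ T ∷ X ∷ l) (++-assoc (replicate (suc m) (suc T)) _ _) ⟨
      range 0 T ++ T ∷ X ∷ (replicate (suc m) (suc T) ++ replicate (suc j) (suc T)) ++ range (suc (suc T)) Q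
                                                                          ≡⟨ cong (λ l → range 0 T ++ T ∷ X ∷ l ++ range (suc (suc T)) Q) (replicate-++ (suc m) (suc j) (suc T)) ⟩
      range 0 T ++ replicate 1 T ++ X ∷ replicate (suc (m ℕ.+ suc j)) (suc T) ++ range (suc (suc T)) Q ∎

  -- The closed walk of a team t < n/2 with n - 2 = 2t + R, provided t < n - 2 (that is, R + t > 0).
  low-walk : ∀ M t R k → M ≡ t ℕ.+ t ℕ.+ R → R ℕ.+ t ≡ suc k →
    cyc (map (venue (suc (suc M)) t) (range 0 (2 ℕ.* suc (suc M) ℕ.∸ 2))) + δ t (suc t)
      ≡ cyc (range 0 (suc M)) + δ t (suc M) + δ (suc M) (suc t)
  low-walk .(t ℕ.+ t ℕ.+ R) t R k refl R+t≡ =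
    trans (cong (λ l → cyc l + δ t (suc t)) (LowTeam.low-venues t R)) (low-tour t R k R+t≡)

  high-walk : ∀ M t Q P' → t ≡ Q ℕ.+ suc P' → M ≡ t ℕ.+ Q →
    cyc (map (venue (suc (suc M)) t) (range 0 (2 ℕ.* suc (suc M) ℕ.∸ 2))) + δ (Q ℕ.+ P') t
      ≡ cyc (range 0 (suc M)) + δ (Q ℕ.+ P') (suc M) + δ (suc M) t
  high-walk .(Q ℕ.+ suc P' ℕ.+ Q) .(Q ℕ.+ suc P') Q P' refl refl = begin
    cyc (map (venue (suc (suc M)) t) (range 0 (2 ℕ.* suc (suc M) ℕ.∸ 2))) + δ T t
                 ≡⟨ cong (λ l → cyc l + δ T t) (HighTeam.high-venues Q P') ⟩
    cyc (replicate (suc P') t ++ range (suc t) Q ++ range 0 t ++ N ∷ replicate (suc (Q ℕ.+ Q)) t) + δ T t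
                 ≡⟨ high-tour t T Q P' N (Q ℕ.+ Q) (ℕ.+-suc Q P') ⟩
    cyc (range 0 (T ℕ.+ suc (suc Q))) + δ T N + δ N t
                 ≡⟨ cong (λ m → cyc (range 0 m) + δ T N + δ N t) size ⟩
    cyc (range 0 N) + δ T N + δ N t ∎
    where
    open ≡-Reasoning
    t : ℕ
    t = Q ℕ.+ suc P'
    T : ℕ
    T = Q ℕ.+ P'
    M : ℕ
    M = t ℕ.+ Q
    N : ℕ
    N = suc M
    size : Q ℕ.+ P' ℕ.+ suc (suc Q) ≡ suc (Q ℕ.+ suc P' ℕ.+ Q)
    size = ℕ-solve (Q ∷ P' ∷ [])

  top-walk : ∀ M →
    cyc (map (venue (suc (suc M)) (suc M)) (range 0 (2 ℕ.* suc (suc M) ℕ.∸ 2)))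
      ≡ cyc (map (oppDRR (suc (suc M)) (suc M)) (range 0 (suc M)) ++ suc M ∷ [])
  top-walk M = begin
    cyc (map (venue (suc (suc M)) (suc M)) (range 0 (2 ℕ.* suc (suc M) ℕ.∸ 2)))
                                                 ≡⟨ cong cyc (TopTeam.top-venues M) ⟩
    cyc (away ++ replicate (suc M) (suc M))      ≡⟨ cong (λ l → cyc (away ++ l)) (++-identityʳ _) ⟨
    cyc (away ++ replicate (suc M) (suc M) ++ [])
                                                 ≡⟨ cyc-stay δ-refl away M (suc M) [] ⟩
    cyc (away ++ suc M ∷ [])                     ∎
    where
    open ≡-Reasoning
    away : List ℕ
    away = map (oppDRR (suc (suc M)) (suc M)) (range 0 (suc M))

-- The theorem's data for n = M + 2 teams; δ reads the distances d on team numbers (team i has venue v_i).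
module Setting (M : ℕ) (d : Fin (suc (suc M)) → Fin (suc (suc M)) → ℚ) where
  n : ℕ
  n = suc (suc M)
  N : ℕ
  N = suc M

  δ : ℕ → ℕ → ℚ
  δ a b = d (idx n a) (idx n b)

  open Cycles δ using (cyc)

  idx-toℕ : ∀ (j : Fin n) → idx n (toℕ j) ≡ j
  idx-toℕ j = trans (Fin.fromℕ<-cong _ _ (m<n⇒m%n≡m (Fin.toℕ<n j)) _ (Fin.toℕ<n j)) (Fin.fromℕ<-toℕ j (Fin.toℕ<n j))

  idx-mod : ∀ k → idx n (k % n) ≡ idx n k
  idx-mod k = Fin.fromℕ<-cong _ _ (m%n%n≡m%n k n) _ _

  travel-as-cyc : ∀ t → travelA n d t ≡ cyc (map (venue n t) (range 0 (2 ℕ.* n ∸ 2)))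
  travel-as-cyc t = SumsAsWalks.sum-as-cyc δ (venue n t) (2 ℕ.* n ∸ 2) (M ℕ.+ N) (Schedule.slot-count M)

  tour-as-cyc : tauPrime n d ≡ cyc (range 0 N)
  tour-as-cyc = trans (SumsAsWalks.sum-as-cyc δ (λ i → i) N M refl) (cong cyc (map-id (range 0 N)))

  hamilton-as-cyc : ∀ π → cycleLength n d π ≡ Cycles.cyc d (map (λ i → π ⟨$⟩ʳ idx n i) (range 0 n))
  hamilton-as-cyc π = trans
    (sumTo-cong n _ _ (λ s _ → cong (λ j → d (π ⟨$⟩ʳ idx n s) (π ⟨$⟩ʳ j)) (sym (idx-mod (suc s)))))
    (SumsAsWalks.sum-as-cyc d (λ i → π ⟨$⟩ʳ idx n i) n (suc M) refl)

  module _ (d-refl : ∀ i → d i i ≡ 0ℚ) where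
    open Tours δ (λ x → d-refl (idx n x))

    low-bound : ∀ (t : Fin n) → toℕ t ℕ.+ toℕ t ≤ℕ M → toℕ t <ℕ M →
      travelA n d (toℕ t)
        ≤ tauPrime n d + d t (idx n N) + d (idx n N) (idx n (suc (toℕ t) mod N)) - d t (idx n (suc (toℕ t) mod N))
    low-bound t 2t≤M t<M = x+c≡y⇒x≤y-c _ _ _ (begin
      travelA n d tn + d t next                 ≡⟨ cong₂ _+_ (travel-as-cyc tn) (cong₂ d (sym (idx-toℕ t)) next≡) ⟩
      cyc (map (venue n tn) (range 0 (2 ℕ.* n ∸ 2))) + δ tn (suc tn)
                                                ≡⟨ low-walk M tn R (pred (R ℕ.+ tn)) M≡ (sym (ℕ.suc-pred (R ℕ.+ tn) {{>-nonZero 0<R+t}})) ⟩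
      cyc (range 0 N) + δ tn N + δ N (suc tn)   ≡⟨ cong₂ (λ a b → a + δ tn N + d (idx n N) b) (sym tour-as-cyc) (sym next≡) ⟩
      tauPrime n d + δ tn N + d (idx n N) next  ≡⟨ cong (λ j → tauPrime n d + d j (idx n N) + d (idx n N) next) (idx-toℕ t) ⟩
      tauPrime n d + d t (idx n N) + d (idx n N) next ∎)
      where
      open ≡-Reasoning
      tn : ℕ
      tn = toℕ t
      next : Fin n
      next = idx n (suc tn mod N)
      next≡ : next ≡ idx n (suc tn)
      next≡ = cong (idx n) (m<n⇒m%n≡m (s≤s t<M))
      R : ℕ
      R = M ∸ (tn ℕ.+ tn)
      M≡ : M ≡ tn ℕ.+ tn ℕ.+ R
      M≡ = sym (ℕ.m+[n∸m]≡n 2t≤M)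
      0<R+t : 0 <ℕ R ℕ.+ tn
      0<R+t = ℕ.+-cancelˡ-< tn 0 (R ℕ.+ tn) (subst₂ _<ℕ_ (sym (ℕ.+-identityʳ tn)) e t<M)
        where
        e : M ≡ tn ℕ.+ (R ℕ.+ tn)
        e = trans M≡ (trans (ℕ.+-assoc tn tn R) (cong (tn ℕ.+_) (ℕ.+-comm tn R)))

    high-bound : ∀ (t : Fin n) → N ≤ℕ toℕ t ℕ.+ toℕ t → toℕ t ≤ℕ M →
      travelA n d (toℕ t)
        ≤ tauPrime n d + d (idx n (toℕ t ∸ 1)) (idx n N) + d (idx n N) t - d (idx n (toℕ t ∸ 1)) t
    high-bound t N≤2t t≤M = x+c≡y⇒x≤y-c _ _ _ (begin
      travelA n d tn + d (idx n (tn ∸ 1)) t      ≡⟨ cong₂ _+_ (travel-as-cyc tn) (cong₂ d (cong (idx n) prev≡) (sym (idx-toℕ t))) ⟩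
      cyc (map (venue n tn) (range 0 (2 ℕ.* n ∸ 2))) + δ (Q ℕ.+ P') tn
                                                 ≡⟨ high-walk M tn Q P' t≡ M≡ ⟩
      cyc (range 0 N) + δ (Q ℕ.+ P') N + δ N tn  ≡⟨ cong₂ (λ a i → a + δ i N + d (idx n N) (idx n tn)) (sym tour-as-cyc) (sym prev≡) ⟩
      tauPrime n d + δ (tn ∸ 1) N + δ N tn       ≡⟨ cong (λ j → tauPrime n d + δ (tn ∸ 1) N + d (idx n N) j) (idx-toℕ t) ⟩
      tauPrime n d + d (idx n (tn ∸ 1)) (idx n N) + d (idx n N) t ∎)
      where
      open ≡-Reasoning
      tn : ℕ
      tn = toℕ t
      Q : ℕ
      Q = M ∸ tn
      M≡ : M ≡ tn ℕ.+ Q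
      M≡ = sym (ℕ.m+[n∸m]≡n t≤M)
      Q<t : Q <ℕ tn
      Q<t = ℕ.+-cancelˡ-≤ tn (suc Q) tn (subst (_≤ℕ tn ℕ.+ tn) (trans (cong suc M≡) (sym (ℕ.+-suc tn Q))) N≤2t)
      P' : ℕ
      P' = tn ∸ suc Q
      t≡ : tn ≡ Q ℕ.+ suc P'
      t≡ = trans (sym (ℕ.m+[n∸m]≡n Q<t)) (sym (ℕ.+-suc Q P'))
      prev≡ : tn ∸ 1 ≡ Q ℕ.+ P'
      prev≡ = trans (cong (_∸ 1) t≡) (cong (_∸ 1) (ℕ.+-suc Q P'))

  module _ (d-nonneg : ∀ i j → 0ℚ ≤ d i j) (d-refl : ∀ i → d i i ≡ 0ℚ) (d-sym : ∀ i j → d i j ≡ d j i)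
           (d-tri : ∀ i j k → d i k ≤ d i j + d j k) (π : Permutation′ n) where
    open Tours δ (λ x → d-refl (idx n x)) using (top-walk)

    short-edges : ∀ a b → δ a b ≤ ½ * cycleLength n d π
    short-edges a b = halve (δ a b) τ (begin
      δ a b + δ a b                 ≡⟨ cong (λ x → δ a b + x) (d-sym (idx n a) (idx n b)) ⟩
      δ a b + δ b a                 ≤⟨ Cycles.round-trip-≤-cyc d d-nonneg d-refl d-tri tour (visits (idx n a)) (visits (idx n b)) ⟩
      Cycles.cyc d tour             ≡⟨ hamilton-as-cyc π ⟨
      τ                             ∎)
      where
      open ℚ.≤-Reasoning
      τ : ℚ
      τ = cycleLength n d π
      w : ℕ → Fin n
      w i = π ⟨$⟩ʳ idx n i
      tour : List (Fin n)
      tour = map w (range 0 n)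
      visits : ∀ p → p ∈ tour
      visits p = subst (_∈ tour) (trans (cong (π ⟨$⟩ʳ_) (idx-toℕ (π ⟨$⟩ˡ p))) (inverseʳ π))
                       (∈-map⁺ w (∈-range 0 (toℕ (π ⟨$⟩ˡ p)) (Fin.toℕ<n (π ⟨$⟩ˡ p))))

    -- Case t = n - 1 of the theorem: n edges, each at most τ/2.
    top-bound : travelA n d N ≤ ((+ n) / 2) * cycleLength n d π
    top-bound = begin
      travelA n d N                         ≡⟨ trans (travel-as-cyc N) (top-walk M) ⟩
      cyc walk                              ≤⟨ Cycles.cyc-≤-half δ τ short-edges walk ⟩
      ((+ length walk) / 2) * τ             ≡⟨ cong (λ k → ((+ k) / 2) * τ) length≡ ⟩
      ((+ n) / 2) * τ                       ∎
      where
      open ℚ.≤-Reasoning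
      τ : ℚ
      τ = cycleLength n d π
      walk : List ℕ
      walk = map (oppDRR n N) (range 0 N) ++ N ∷ []
      length≡ : length walk ≡ n
      length≡ = trans (length-++ (map (oppDRR n N) (range 0 N)))
                 (trans (cong (ℕ._+ 1) (trans (length-map (oppDRR n N) (range 0 N)) (length-range 0 N))) (ℕ.+-comm N 1))

lemma4 : (n : ℕ) → .{{_ : NonZero n}} → 2 ∣ n → 4 ≤ℕ n →
         (d : Fin n → Fin n → ℚ) →
         (∀ i j → 0ℚ ≤ d i j) →
         (∀ i → d i i ≡ 0ℚ) →
         (∀ i j → d i j ≡ d j i) →
         (∀ i j k → d i k ≤ d i j + d j k) →
         (∀ v → rowSum n d (idx n (n ∸ 1)) ≤ rowSum n d v) →
         (t : Fin n) →
         ((toℕ t <ℕ n /ℕ 2 →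
            travelA n d (toℕ t)
              ≤ tauPrime n d + d t (idx n (n ∸ 1))
                + d (idx n (n ∸ 1)) (idx n (suc (toℕ t) mod (n ∸ 1)))
                - d t (idx n (suc (toℕ t) mod (n ∸ 1))))
         × (n /ℕ 2 ≤ℕ toℕ t → toℕ t ≤ℕ n ∸ 2 →
            travelA n d (toℕ t)
              ≤ tauPrime n d + d (idx n (toℕ t ∸ 1)) (idx n (n ∸ 1))
                + d (idx n (n ∸ 1)) t
                - d (idx n (toℕ t ∸ 1)) t)
         × (toℕ t ≡ n ∸ 1 →
            (π : Permutation′ n) →
            travelA n d (toℕ t) ≤ ((+ n) / 2) * cycleLength n d π))
lemma4 .0 (divides zero refl) ()
lemma4 .2 (divides 1 refl) (s≤s (s≤s ()))
lemma4 .(suc (suc k) ℕ.* 2) (divides (suc (suc k)) refl) _ d d-nonneg d-refl d-sym d-tri _ t =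
    (λ t<n/2 → low-bound d-refl t (2t≤M t<n/2) (t<M t<n/2))
  , (λ n/2≤t t≤M → high-bound d-refl t (N≤2t n/2≤t) t≤M)
  , (λ t≡N π → subst (λ x → travelA n d x ≤ ((+ n) / 2) * cycleLength n d π) (sym t≡N)
                     (top-bound d-nonneg d-refl d-sym d-tri π))
  where
  -- Here n = 2k + 4, so n - 2 = 2k + 2 and n/2 = k + 2.
  open Setting (suc (suc (k ℕ.* 2))) d

  half≡ : n /ℕ 2 ≡ suc (suc k)
  half≡ = m*n/n≡m (suc (suc k)) 2

  t≤k+1 : toℕ t <ℕ n /ℕ 2 → toℕ t ≤ℕ suc k
  t≤k+1 t<n/2 = ℕ.≤-pred (subst (toℕ t <ℕ_) half≡ t<n/2)

  2t≤M : toℕ t <ℕ n /ℕ 2 → toℕ t ℕ.+ toℕ t ≤ℕ suc (suc (k ℕ.* 2))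
  2t≤M t<n/2 = ℕ.≤-trans (ℕ.+-mono-≤ (t≤k+1 t<n/2) (t≤k+1 t<n/2)) (ℕ.≤-reflexive 2k+2≡)
    where
    2k+2≡ : suc k ℕ.+ suc k ≡ suc (suc (k ℕ.* 2))
    2k+2≡ = ℕ-solve (k ∷ [])

  t<M : toℕ t <ℕ n /ℕ 2 → toℕ t <ℕ suc (suc (k ℕ.* 2))
  t<M t<n/2 = s≤s (ℕ.≤-trans (t≤k+1 t<n/2) (s≤s (ℕ.m≤m*n k 2)))

  N≤2t : n /ℕ 2 ≤ℕ toℕ t → N ≤ℕ toℕ t ℕ.+ toℕ t
  N≤2t n/2≤t = ℕ.≤-trans (ℕ.n≤1+n N) (subst (_≤ℕ toℕ t ℕ.+ toℕ t) 2k+4≡ (ℕ.+-mono-≤ k+2≤t k+2≤t))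
    where
    k+2≤t : suc (suc k) ≤ℕ toℕ t
    k+2≤t = subst (_≤ℕ toℕ t) half≡ n/2≤t
    2k+4≡ : suc (suc k) ℕ.+ suc (suc k) ≡ suc (suc (suc (suc (k ℕ.* 2))))
    2k+4≡ = ℕ-solve (k ∷ [])
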